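{- Let $m\ge 0$ and $n\ge 0$ be integers. Then $u(m,n)$ equals the number of partitions $\mu$ of $n-\binom{m}{2}$ satisfying both of the following conditions: (1) $\mathrm{rank}(\mu)\le -2m$; (2) $m-1$ belongs to the rank-set of $\mu$.
   Context: A strongly unimodal sequence of weight $n$ is a finite sequence of positive integers $(a_1,\ldots,a_\ell)$ such that, for some $k$ with $1\le k\le\ell$, $$a_1<\cdots<a_{k-1}<a_k>a_{k+1}>\cdots>a_\ell\ge 1,$$ and $\sum_i a_i=n$. Its rank is $\ell-2k+1$. $u(m,n)$ is the number of strongly unimodal sequences of weight $n$ and rank $m$. For a partition $\lambda=(\lambda_1\ge\cdots\ge\lambda_{\ell(\lambda)}\ge1)$, set $\lambda_k=0$ for $k>\ell(\lambda)$. Its rank is $\mathrm{rank}(\lambda)=\lambda_1-\ell(\lambda)$, and its rank-set is the set $\{j-\lambda_{j+1}: j\ge 0\}$. -}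

module Defs where

open import Data.Nat using (ℕ; zero; suc; _<_; _≤_; _≥_)
open import Data.Nat.Combinatorics using (_C_)
open import Data.Integer as ℤ using (ℤ; +_)
open import Data.List using (List; []; _∷_; _++_; [_]; length)
open import Data.Nat.ListAction using (sum)
open import Data.List.Relation.Unary.All using (All)
open import Data.List.Relation.Unary.Linked using (Linked)
open import Data.Product using (Σ; _×_; ∃)
open import Relation.Binary.PropositionalEquality using (_≡_)

-- A strongly unimodal sequence a_1 < ... < a_{k-1} < a_k > a_{k+1} > ... > a_ℓ ≥ 1
-- is recorded by its three pieces: the strictly increasing part
-- xs = (a_1,...,a_{k-1}), the peak a_k, and the strictly decreasing part
-- ys = (a_{k+1},...,a_ℓ).  The underlying sequence is  xs ++ [peak] ++ ys,
-- and this decomposition is unique (the peak is the maximum), so these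
-- triples are in bijection with strongly unimodal sequences.

record SUS : Set where
  constructor sus
  field
    before : List ℕ
    peak   : ℕ
    after  : List ℕ

open SUS public

seq : SUS → List ℕ
seq s = before s ++ [ peak s ] ++ after s

IsStronglyUnimodal : SUS → Set
IsStronglyUnimodal s =
  All (λ a → 1 ≤ a) (seq s) ×
  Linked _<_ (before s) ×
  All (_< peak s) (before s) ×
  All (_< peak s) (after s) ×
  Linked _>_ (after s)
  where
    _>_ : ℕ → ℕ → Set
    a > b = b < a

weightS : SUS → ℕ
weightS s = sum (seq s)

rankS : SUS → ℤ
rankS s = (+ length (seq s)) ℤ.- (+ 2) ℤ.* (+ suc (length (before s))) ℤ.+ (+ 1)

-- strongly unimodal sequences of weight n and rank m;  u(m,n) = #SUSeq m n
SUSeq : ℤ → ℕ → Set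
SUSeq m n = Σ SUS (λ s → IsStronglyUnimodal s × weightS s ≡ n × rankS s ≡ m)

IsPartition : List ℕ → Set
IsPartition λs = Linked _≥_ λs × All (λ a → 1 ≤ a) λs

-- entry λs j = λ_{j+1}  (with λ_k = 0 for k > ℓ(λ))
entry : List ℕ → ℕ → ℕ
entry []       _       = 0
entry (x ∷ _)  zero    = x
entry (_ ∷ xs) (suc j) = entry xs j

rankP : List ℕ → ℤ
rankP λs = (+ entry λs 0) ℤ.- (+ length λs)

InRankSet : ℤ → List ℕ → Set
InRankSet r λs = Σ ℕ (λ j → (+ j) ℤ.- (+ entry λs j) ≡ r)

Part : ℕ → ℤ → Set
Part m N = Σ (List ℕ) (λ μ →
  IsPartition μ × (+ sum μ) ≡ N ×
  rankP μ ℤ.≤ ℤ.- ((+ 2) ℤ.* (+ m)) ×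
  InRankSet ((+ m) ℤ.- (+ 1)) μ)

-- Write a strongly unimodal sequence of rank m as a₁ < ⋯ < a_k < p > b₁ > ⋯ > b_l, so that
-- l = k + m, and put d = k + 1.  The increasing side 0 < a₁ < ⋯ < a_k < p is recorded by its
-- gaps: the partition β with parts ≤ d having a_{i+1} − a_i − 1 parts equal to d − i
-- (a₀ = 0, a_{k+1} = p), so that p = ℓ(β) + d.  The decreasing side becomes a partition with
-- parts ≥ d after subtracting the staircase (l, …, 2, 1) and adding d to every part.  Joining
-- the two around one more part d gives μ with μ_{l+1} = d, i.e. l − μ_{l+1} = m − 1 is in the
-- rank-set of μ, and the peak condition b₁ < p turns into rank(μ) ≤ −2m.  The two sides lose
-- C(d+1,2) and C(l+1,2) − l·d of their weight, and C(d+1,2) + C(l+1,2) = d + l·d + C(m,2), so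
-- |μ| is the weight minus C(m,2).  Conversely, the rank-set condition locates the part d in μ.

module Submission where

open import Defs
open import Data.Nat using (ℕ)
open import Data.Nat.Combinatorics using (_C_)
open import Data.Integer as ℤ using (ℤ; +_)
open import Function.Bundles using (_↔_)

open import Axiom.UniquenessOfIdentityProofs using (UIP; module Decidable⇒UIP)
open import Data.Integer using (+≤+; 0ℤ)
import Data.Integer.Properties as ℤ
import Data.Integer.Tactic.RingSolver as ℤ-Solver
open import Data.List using (List; []; _∷_; _++_; length; replicate; take; drop)
open import Data.List.Properties using (length-++; length-replicate; length-take; ++-identityʳ)
open import Data.List.Relation.Unary.All as All using (All; []; _∷_)
import Data.List.Relation.Unary.All.Properties as All
import Data.List.Relation.Unary.AllPairs as AllPairs
open import Data.List.Relation.Unary.Linked as Linked using (Linked; []; [-]; _∷_)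
open import Data.List.Relation.Unary.Linked.Properties using (Linked⇒AllPairs)
open import Data.Nat using (zero; suc; pred; _+_; _*_; _∸_; _<_; _≤_; _≥_; _>_; z≤n; s≤s; _≟_; _<?_; >-nonZero)
open import Data.Nat.Combinatorics using (nCk+nC[k+1]≡[n+1]C[k+1]; nC1≡n)
open import Data.Nat.ListAction using (sum)
open import Data.Nat.ListAction.Properties using (sum-++)
open import Data.Nat.Properties
import Data.Nat.Tactic.RingSolver as ℕ-Solver
open import Data.Product using (_×_; _,_; proj₁; proj₂; map₁; uncurry)
open import Function.Bundles using (_⇔_; mk⇔; mk↔ₛ′; Equivalence)
open import Function.Properties.Equivalence using (⇔-setoid)
open import Level using (Level; 0ℓ)
open import Relation.Binary.Core using (Rel)
open import Relation.Binary.Definitions using (Transitive)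
open import Relation.Binary.Properties.Poset ≤-poset using (≥-trans)
open import Relation.Binary.Properties.StrictPartialOrder <-strictPartialOrder using (>-trans)
open import Relation.Binary.PropositionalEquality
import Relation.Binary.Reasoning.Setoid as SetoidReasoning
open import Relation.Nullary using (Irrelevant; yes; no; contradiction)

open Equivalence using (to; from)

private
  variable
    ℓ₁ ℓ₂ : Level
    X : Set ℓ₁
    R : Rel X ℓ₂
    x y : X
    xs ys : List X

pos-diff≡pos-diff⇔ : ∀ a b c e → (+ a ℤ.- + b ≡ + c ℤ.- + e) ⇔ (a + e ≡ b + c)
pos-diff≡pos-diff⇔ a b c e = mk⇔
  (λ eq → ℤ.+-injective (begin
    + (a + e)                       ≡⟨ ℤ.pos-+ a e ⟩
    + a ℤ.+ + e                     ≡⟨ regroup (+ a) (+ b) (+ e) ⟩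
    (+ a ℤ.- + b) ℤ.+ (+ b ℤ.+ + e) ≡⟨ cong (ℤ._+ (+ b ℤ.+ + e)) eq ⟩
    (+ c ℤ.- + e) ℤ.+ (+ b ℤ.+ + e) ≡⟨ cancel (+ c) (+ e) (+ b) ⟩
    + b ℤ.+ + c                     ≡⟨ ℤ.pos-+ b c ⟨
    + (b + c)                       ∎))
  (λ eq → begin
    + a ℤ.- + b                     ≡⟨ extend (+ a) (+ b) (+ e) ⟩
    (+ a ℤ.+ + e) ℤ.- (+ b ℤ.+ + e) ≡⟨ cong (ℤ._- (+ b ℤ.+ + e)) (ℤ.pos-+ a e) ⟨
    + (a + e) ℤ.- (+ b ℤ.+ + e)     ≡⟨ cong (λ x → + x ℤ.- (+ b ℤ.+ + e)) eq ⟩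
    + (b + c) ℤ.- (+ b ℤ.+ + e)     ≡⟨ cong (ℤ._- (+ b ℤ.+ + e)) (ℤ.pos-+ b c) ⟩
    (+ b ℤ.+ + c) ℤ.- (+ b ℤ.+ + e) ≡⟨ shorten (+ b) (+ c) (+ e) ⟩
    + c ℤ.- + e                     ∎)
  where
  open ≡-Reasoning
  regroup : ∀ x y z → x ℤ.+ z ≡ (x ℤ.- y) ℤ.+ (y ℤ.+ z)
  regroup = ℤ-Solver.solve-∀
  cancel : ∀ x z y → (x ℤ.- z) ℤ.+ (y ℤ.+ z) ≡ y ℤ.+ x
  cancel = ℤ-Solver.solve-∀
  extend : ∀ x y z → x ℤ.- y ≡ (x ℤ.+ z) ℤ.- (y ℤ.+ z)
  extend = ℤ-Solver.solve-∀
  shorten : ∀ y x z → (y ℤ.+ x) ℤ.- (y ℤ.+ z) ≡ x ℤ.- z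
  shorten = ℤ-Solver.solve-∀

pos-diff≡pos⇔ : ∀ a b c → (+ a ℤ.- + b ≡ + c) ⇔ (a ≡ b + c)
pos-diff≡pos⇔ a b c = mk⇔
  (λ eq → ℤ.+-injective (begin
    + a                      ≡⟨ regroup (+ a) (+ b) ⟩
    + b ℤ.+ (+ a ℤ.- + b)    ≡⟨ cong (λ x → + b ℤ.+ x) eq ⟩
    + b ℤ.+ + c              ≡⟨ ℤ.pos-+ b c ⟨
    + (b + c)                ∎))
  (λ eq → begin
    + a ℤ.- + b              ≡⟨ cong (λ x → + x ℤ.- + b) eq ⟩
    + (b + c) ℤ.- + b        ≡⟨ cong (ℤ._- + b) (ℤ.pos-+ b c) ⟩
    (+ b ℤ.+ + c) ℤ.- + b    ≡⟨ cancel (+ b) (+ c) ⟩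
    + c                      ∎)
  where
  open ≡-Reasoning
  regroup : ∀ x y → x ≡ y ℤ.+ (x ℤ.- y)
  regroup = ℤ-Solver.solve-∀
  cancel : ∀ x y → (x ℤ.+ y) ℤ.- x ≡ y
  cancel = ℤ-Solver.solve-∀

pos-diff≤-2*⇔ : ∀ a b m → (+ a ℤ.- + b ℤ.≤ ℤ.- (+ 2 ℤ.* + m)) ⇔ (a + 2 * m ≤ b)
pos-diff≤-2*⇔ a b m = mk⇔
  (λ le → ℤ.drop‿+≤+ (ℤ.i-j≤0⇒i≤j (subst (ℤ._≤ 0ℤ) shift (ℤ.i≤j⇒i-j≤0 le))))
  (λ le → ℤ.i-j≤0⇒i≤j (subst (ℤ._≤ 0ℤ) (sym shift) (ℤ.i≤j⇒i-j≤0 (+≤+ le))))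
  where
  open ≡-Reasoning
  shift : (+ a ℤ.- + b) ℤ.- ℤ.- (+ 2 ℤ.* + m) ≡ + (a + 2 * m) ℤ.- + b
  shift = begin
    (+ a ℤ.- + b) ℤ.- ℤ.- (+ 2 ℤ.* + m) ≡⟨ regroup (+ a) (+ b) (+ 2 ℤ.* + m) ⟩
    (+ a ℤ.+ + 2 ℤ.* + m) ℤ.- + b       ≡⟨ cong (λ x → (+ a ℤ.+ x) ℤ.- + b) (ℤ.pos-* 2 m) ⟨
    (+ a ℤ.+ + (2 * m)) ℤ.- + b         ≡⟨ cong (ℤ._- + b) (ℤ.pos-+ a (2 * m)) ⟨
    + (a + 2 * m) ℤ.- + b               ∎
    where
    regroup : ∀ x y z → (x ℤ.- y) ℤ.- ℤ.- z ≡ (x ℤ.+ z) ℤ.- y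
    regroup = ℤ-Solver.solve-∀

rankS-sus : ∀ A p B → rankS (sus A p B) ≡ + length B ℤ.- + length A
rankS-sus A p B = begin
  + length (A ++ p ∷ B) ℤ.- + 2 ℤ.* + suc a ℤ.+ + 1
    ≡⟨ cong (λ l → + l ℤ.- + 2 ℤ.* + suc a ℤ.+ + 1) (length-++ A) ⟩
  + (a + suc b) ℤ.- + 2 ℤ.* (+ 1 ℤ.+ + a) ℤ.+ + 1
    ≡⟨ cong (λ x → x ℤ.- + 2 ℤ.* (+ 1 ℤ.+ + a) ℤ.+ + 1) (ℤ.pos-+ a (suc b)) ⟩
  (+ a ℤ.+ (+ 1 ℤ.+ + b)) ℤ.- + 2 ℤ.* (+ 1 ℤ.+ + a) ℤ.+ + 1
    ≡⟨ simplify (+ a) (+ b) ⟩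
  + b ℤ.- + a ∎
  where
  open ≡-Reasoning
  a = length A
  b = length B
  simplify : ∀ x y → (x ℤ.+ (+ 1 ℤ.+ y)) ℤ.- + 2 ℤ.* (+ 1 ℤ.+ x) ℤ.+ + 1 ≡ y ℤ.- x
  simplify = ℤ-Solver.solve-∀

-- Triangular numbers

triangle : ℕ → ℕ
triangle zero    = 0
triangle (suc n) = n + triangle n

C2≡triangle : ∀ m → m C 2 ≡ triangle m
C2≡triangle zero    = refl
C2≡triangle (suc m) = begin
  suc m C 2         ≡⟨ nCk+nC[k+1]≡[n+1]C[k+1] m 1 ⟨
  m C 1 + m C 2     ≡⟨ cong₂ _+_ (nC1≡n m) (C2≡triangle m) ⟩
  m + triangle m    ∎
  where open ≡-Reasoning

triangle-+ : ∀ a b → triangle (a + b) ≡ triangle a + a * b + triangle b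
triangle-+ zero    b = refl
triangle-+ (suc a) b = begin
  (a + b) + triangle (a + b)                  ≡⟨ cong (λ x → (a + b) + x) (triangle-+ a b) ⟩
  (a + b) + (triangle a + a * b + triangle b) ≡⟨ regroup a b (triangle a) (triangle b) ⟩
  (a + triangle a) + suc a * b + triangle b   ∎
  where
  open ≡-Reasoning
  regroup : ∀ a b s t → (a + b) + (s + a * b + t) ≡ (a + s) + suc a * b + t
  regroup = ℕ-Solver.solve-∀

triangle-suc+triangle : ∀ d → triangle (suc d) + triangle d ≡ d * d
triangle-suc+triangle zero    = refl
triangle-suc+triangle (suc d) = begin
  (suc d + (d + triangle d)) + (d + triangle d) ≡⟨ regroup d (triangle d) ⟩
  (d + triangle d + triangle d) + (d + suc d)   ≡⟨ cong (_+ (d + suc d)) (triangle-suc+triangle d) ⟩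
  d * d + (d + suc d)                           ≡⟨ square-suc d ⟩
  suc d * suc d                                 ∎
  where
  open ≡-Reasoning
  regroup : ∀ d t → (suc d + (d + t)) + (d + t) ≡ (d + t + t) + (d + suc d)
  regroup = ℕ-Solver.solve-∀
  square-suc : ∀ d → d * d + (d + suc d) ≡ suc d * suc d
  square-suc = ℕ-Solver.solve-∀

triangle-[1+d]+triangle-[1+l] : ∀ d m l → suc l ≡ d + m →
  triangle (suc d) + triangle (suc l) ≡ d + triangle m + l * d
triangle-[1+d]+triangle-[1+l] d m l eq = begin
  triangle (suc d) + triangle (suc l)                 ≡⟨ cong (λ x → triangle (suc d) + triangle x) eq ⟩
  (d + triangle d) + triangle (d + m)                 ≡⟨ cong (λ x → (d + triangle d) + x) (triangle-+ d m) ⟩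
  (d + triangle d) + (triangle d + d * m + triangle m) ≡⟨ regroup d (triangle d) (triangle m) m ⟩
  d + triangle m + (2 * triangle d + d * m)           ≡⟨ cong (λ x → d + triangle m + x) square ⟩
  d + triangle m + l * d                              ∎
  where
  open ≡-Reasoning
  regroup : ∀ d s t m → (d + s) + (s + d * m + t) ≡ d + t + (2 * s + d * m)
  regroup = ℕ-Solver.solve-∀
  square : 2 * triangle d + d * m ≡ l * d
  square = +-cancelʳ-≡ d _ _ (begin
    2 * triangle d + d * m + d                  ≡⟨ regroup′ d (triangle d) m ⟩
    (triangle (suc d) + triangle d) + d * m     ≡⟨ cong (_+ d * m) (triangle-suc+triangle d) ⟩
    d * d + d * m                               ≡⟨ *-distribˡ-+ d d m ⟨
    d * (d + m)                                 ≡⟨ cong (d *_) eq ⟨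
    d * suc l                                   ≡⟨ *-comm d (suc l) ⟩
    d + l * d                                   ≡⟨ +-comm d (l * d) ⟩
    l * d + d                                   ∎)
    where
    regroup′ : ∀ d s m → 2 * s + d * m + d ≡ (d + s + s) + d * m
    regroup′ = ℕ-Solver.solve-∀

linked⇒All-head : Transitive R → Linked R (x ∷ xs) → All (R x) xs
linked⇒All-head trans linked = AllPairs.head (Linked⇒AllPairs trans linked)

linked-∷ : ∀ {y ys} → All (_≤ y) ys → Linked _≥_ ys → Linked _≥_ (y ∷ ys)
linked-∷ []        []     = [-]
linked-∷ (z≤y ∷ _) linked = z≤y ∷ linked

linked-++⁻ˡ : ∀ xs → Linked R (xs ++ ys) → Linked R xs
linked-++⁻ˡ []           _              = []
linked-++⁻ˡ (x ∷ [])     _              = [-]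
linked-++⁻ˡ (x ∷ y ∷ xs) (Rxy ∷ linked) = Rxy ∷ linked-++⁻ˡ (y ∷ xs) linked

linked-++⁻ʳ : ∀ xs → Linked R (xs ++ ys) → Linked R ys
linked-++⁻ʳ []       linked = linked
linked-++⁻ʳ (x ∷ xs) linked = linked-++⁻ʳ xs (Linked.tail linked)

linked-drop : ∀ k → Linked R xs → Linked R (drop k xs)
linked-drop zero    linked       = linked
linked-drop (suc k) []           = []
linked-drop (suc k) [-]          = linked-drop k []
linked-drop (suc k) (_ ∷ linked) = linked-drop k linked

entry-++-length : ∀ xs {y ys} → entry (xs ++ y ∷ ys) (length xs) ≡ y
entry-++-length []       = refl
entry-++-length (x ∷ xs) = entry-++-length xs

take-++-length : ∀ xs → take (length xs) (xs ++ ys) ≡ xs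
take-++-length []       = refl
take-++-length (x ∷ xs) = cong (x ∷_) (take-++-length xs)

drop-++∷-length : ∀ xs → drop (suc (length xs)) (xs ++ y ∷ ys) ≡ ys
drop-++∷-length []       = refl
drop-++∷-length (x ∷ xs) = drop-++∷-length xs

take++entry∷drop : ∀ j {μ} → j < length μ → take j μ ++ entry μ j ∷ drop (suc j) μ ≡ μ
take++entry∷drop zero    {x ∷ μ} _         = refl
take++entry∷drop (suc j) {x ∷ μ} (s≤s j<) = cong (x ∷_) (take++entry∷drop j j<)

entry-≥length : ∀ j μ → length μ ≤ j → entry μ j ≡ 0
entry-≥length j       []      _         = refl
entry-≥length (suc j) (x ∷ μ) (s≤s ℓ≤j) = entry-≥length j μ ℓ≤j

record IsPartitionAround (xs : List ℕ) (d : ℕ) (β : List ℕ) : Set where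
  field
    prefix-linked : Linked _≥_ xs
    prefix-≥      : All (d ≤_) xs
    pivot-pos     : 1 ≤ d
    suffix        : IsPartition β
    suffix-≤      : All (_≤ d) β

IsPartition-++∷⇔ : ∀ xs {d β} → IsPartition (xs ++ d ∷ β) ⇔ IsPartitionAround xs d β
IsPartition-++∷⇔ xs {d} {β} = mk⇔
  (λ (linked , pos) → record
    { prefix-linked = linked-++⁻ˡ xs linked
    ; prefix-≥      = bounded xs linked
    ; pivot-pos     = All.head (All.++⁻ʳ xs pos)
    ; suffix        = Linked.tail (linked-++⁻ʳ xs linked) , All.tail (All.++⁻ʳ xs pos)
    ; suffix-≤      = linked⇒All-head ≥-trans (linked-++⁻ʳ xs linked)
    })
  (λ around → let open IsPartitionAround around in
    join prefix-linked prefix-≥ (linked-∷ suffix-≤ (proj₁ suffix)) ,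
    All.++⁺ (All.map (≤-trans pivot-pos) prefix-≥) (pivot-pos ∷ proj₂ suffix))
  where
  bounded : ∀ xs → Linked _≥_ (xs ++ d ∷ β) → All (d ≤_) xs
  bounded []       _      = []
  bounded (x ∷ xs) linked =
    All.head (All.++⁻ʳ xs (linked⇒All-head ≥-trans linked)) ∷ bounded xs (Linked.tail linked)
  join : ∀ {xs} → Linked _≥_ xs → All (d ≤_) xs → Linked _≥_ (d ∷ β) → Linked _≥_ (xs ++ d ∷ β)
  join []              []          linked = linked
  join [-]             (d≤x ∷ [])  linked = d≤x ∷ linked
  join (Rxy ∷ linkedx) (_ ∷ d≤xs)  linked = Rxy ∷ join linkedx d≤xs linked

rankSet-index<length : ∀ {μ j m} → suc j ≡ entry μ j + m → entry μ 0 + 2 * m ≤ length μ → j < length μ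
rankSet-index<length {μ} {j} {m} eq bound with j <? length μ
... | yes j<ℓ = j<ℓ
... | no  j≮ℓ = contradiction bound (<⇒≱ (begin-strict
  length μ           ≤⟨ ℓ≤j ⟩
  j                  <⟨ n<1+n j ⟩
  suc j              ≡⟨ trans eq (cong (_+ m) (entry-≥length j μ ℓ≤j)) ⟩
  m                  ≤⟨ m≤n+m m (entry μ 0 + m) ⟩
  entry μ 0 + m + m  ≡⟨ regroup (entry μ 0) m ⟩
  entry μ 0 + 2 * m  ∎))
  where
  open ≤-Reasoning
  ℓ≤j = ≮⇒≥ j≮ℓ
  regroup : ∀ a m → a + m + m ≡ a + 2 * m
  regroup = ℕ-Solver.solve-∀

-- Strict partitions and the staircase

IsStrictPartition : List ℕ → Set
IsStrictPartition bs = Linked _>_ bs × All (1 ≤_) bs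

flatten : ℕ → List ℕ → List ℕ
flatten d []       = []
flatten d (b ∷ bs) = b + d ∸ suc (length bs) ∷ flatten d bs

sharpen : ℕ → List ℕ → List ℕ
sharpen d []       = []
sharpen d (x ∷ xs) = x ∸ d + suc (length xs) ∷ sharpen d xs

length-flatten : ∀ d bs → length (flatten d bs) ≡ length bs
length-flatten d []       = refl
length-flatten d (b ∷ bs) = cong suc (length-flatten d bs)

length-sharpen : ∀ d xs → length (sharpen d xs) ≡ length xs
length-sharpen d []       = refl
length-sharpen d (x ∷ xs) = cong suc (length-sharpen d xs)

strictPartition-tail : ∀ {b bs} → IsStrictPartition (b ∷ bs) → IsStrictPartition bs
strictPartition-tail (decr , _ ∷ pos) = Linked.tail decr , pos

strictPartition-head≥length : ∀ {b bs} → IsStrictPartition (b ∷ bs) → length (b ∷ bs) ≤ b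
strictPartition-head≥length {bs = []}    (_ , 1≤b ∷ _)     = 1≤b
strictPartition-head≥length {bs = _ ∷ _} (b′<b ∷ decr , _ ∷ pos) =
  ≤-trans (s≤s (strictPartition-head≥length (decr , pos))) b′<b

sharpen-flatten : ∀ d {bs} → IsStrictPartition bs → sharpen d (flatten d bs) ≡ bs
sharpen-flatten d {[]}     _      = refl
sharpen-flatten d {b ∷ bs} strict rewrite length-flatten d bs =
  cong₂ _∷_ (begin
    b + d ∸ l ∸ d + l   ≡⟨ cong (λ x → x ∸ d + l) (+-∸-comm d l≤b) ⟩
    b ∸ l + d ∸ d + l   ≡⟨ cong (_+ l) (m+n∸n≡m (b ∸ l) d) ⟩
    b ∸ l + l           ≡⟨ m∸n+n≡m l≤b ⟩
    b                   ∎)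
    (sharpen-flatten d (strictPartition-tail strict))
  where
  open ≡-Reasoning
  l = suc (length bs)
  l≤b = strictPartition-head≥length strict

flatten-sharpen : ∀ d {xs} → All (d ≤_) xs → flatten d (sharpen d xs) ≡ xs
flatten-sharpen d {[]}     []             = refl
flatten-sharpen d {x ∷ xs} (d≤x ∷ d≤xs) rewrite length-sharpen d xs =
  cong₂ _∷_ (begin
    x ∸ d + l + d ∸ l   ≡⟨ cong (_∸ l) (+-comm (x ∸ d + l) d) ⟩
    d + (x ∸ d + l) ∸ l ≡⟨ cong (_∸ l) (+-assoc d (x ∸ d) l) ⟨
    d + (x ∸ d) + l ∸ l ≡⟨ m+n∸n≡m (d + (x ∸ d)) l ⟩
    d + (x ∸ d)         ≡⟨ m+[n∸m]≡n d≤x ⟩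
    x                   ∎)
    (flatten-sharpen d d≤xs)
  where
  open ≡-Reasoning
  l = suc (length xs)

flatten-≥ : ∀ d {bs} → IsStrictPartition bs → All (d ≤_) (flatten d bs)
flatten-≥ d {[]}     _      = []
flatten-≥ d {b ∷ bs} strict =
  subst (d ≤_) (sym (+-∸-comm d (strictPartition-head≥length strict))) (m≤n+m d _)
  ∷ flatten-≥ d (strictPartition-tail strict)

flatten-linked : ∀ d {bs} → IsStrictPartition bs → Linked _≥_ (flatten d bs)
flatten-linked d {[]}          _                    = []
flatten-linked d {b ∷ []}      _                    = [-]
flatten-linked d {b ∷ b′ ∷ bs} strict@(b′<b ∷ _ , _) =
  ∸-monoˡ-≤ (2 + length bs) (+-monoˡ-≤ d b′<b) ∷ flatten-linked d (strictPartition-tail strict)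

sharpen-strictPartition : ∀ d {xs} → Linked _≥_ xs → IsStrictPartition (sharpen d xs)
sharpen-strictPartition d {xs} linked = decreasing linked , positive xs
  where
  decreasing : ∀ {xs} → Linked _≥_ xs → Linked _>_ (sharpen d xs)
  decreasing []              = []
  decreasing [-]             = [-]
  decreasing (x′≤x ∷ linked) = +-mono-≤-< (∸-monoˡ-≤ d x′≤x) ≤-refl ∷ decreasing linked
  positive : ∀ xs → All (1 ≤_) (sharpen d xs)
  positive []       = []
  positive (x ∷ xs) = ≤-trans (s≤s z≤n) (m≤n+m _ (x ∸ d)) ∷ positive xs

sum-flatten : ∀ d {bs} → IsStrictPartition bs →
  sum (flatten d bs) + triangle (suc (length bs)) ≡ sum bs + length bs * d
sum-flatten d {[]}     _      = refl
sum-flatten d {b ∷ bs} strict = begin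
  (b + d ∸ l) + sum (flatten d bs) + (l + triangle l)
    ≡⟨ regroup (b + d ∸ l) (sum (flatten d bs)) l (triangle l) ⟩
  (b + d ∸ l + l) + (sum (flatten d bs) + triangle l)
    ≡⟨ cong₂ _+_ (m∸n+n≡m l≤b+d) (sum-flatten d (strictPartition-tail strict)) ⟩
  (b + d) + (sum bs + length bs * d)
    ≡⟨ regroup′ b d (sum bs) (length bs) ⟩
  b + sum bs + l * d ∎
  where
  open ≡-Reasoning
  l = suc (length bs)
  l≤b+d = ≤-trans (strictPartition-head≥length strict) (m≤m+n b d)
  regroup : ∀ e s l t → e + s + (l + t) ≡ (e + l) + (s + t)
  regroup = ℕ-Solver.solve-∀
  regroup′ : ∀ b d s l → (b + d) + (s + l * d) ≡ b + s + suc l * d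
  regroup′ = ℕ-Solver.solve-∀

decreasing-All<⇔head< : ∀ {b bs c} → Linked _>_ (b ∷ bs) → All (_< c) (b ∷ bs) ⇔ b < c
decreasing-All<⇔head< decreasing = mk⇔
  All.head
  (λ b<c → b<c ∷ All.map (λ b′<b → <-trans b′<b b<c) (linked⇒All-head >-trans decreasing))

+-cancelʳ-≤⇔ : ∀ k {x y} → (x + k ≤ y + k) ⇔ (x ≤ y)
+-cancelʳ-≤⇔ k = mk⇔ (+-cancelʳ-≤ k _ _) (+-monoˡ-≤ k)

flatten-head-bound⇔ : ∀ {b l d m t} → l ≤ b → suc l ≡ d + m →
  (b + d ∸ l + 2 * m ≤ l + suc t) ⇔ (b < t + d)
flatten-head-bound⇔ {b} {l} {d} {m} {t} l≤b eq = begin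
  b + d ∸ l + 2 * m ≤ l + suc t     ≡⟨ cong₂ _≤_ rank≡ length≡ ⟩
  e + m + (d + m) ≤ t + (d + m)     ≈⟨ +-cancelʳ-≤⇔ (d + m) ⟩
  e + m ≤ t                         ≈⟨ +-cancelʳ-≤⇔ d ⟨
  e + m + d ≤ t + d                 ≡⟨ cong (_≤ t + d) peak≡ ⟨
  b < t + d                         ∎
  where
  open SetoidReasoning (⇔-setoid 0ℓ)
  e = b ∸ l
  rank≡ : b + d ∸ l + 2 * m ≡ e + m + (d + m)
  rank≡ = trans (cong (_+ 2 * m) (+-∸-comm d l≤b)) (regroup e d m)
    where
    regroup : ∀ e d m → e + d + 2 * m ≡ e + m + (d + m)
    regroup = ℕ-Solver.solve-∀
  length≡ : l + suc t ≡ t + (d + m)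
  length≡ = trans (+-suc l t) (trans (cong (_+ t) eq) (+-comm (d + m) t))
  peak≡ : suc b ≡ e + m + d
  peak≡ = trans (cong suc (sym (m∸n+n≡m l≤b)))
                (trans (sym (+-suc e l)) (trans (cong (λ x → e + x) eq) (regroup e d m)))
    where
    regroup : ∀ e d m → e + (d + m) ≡ e + m + d
    regroup = ℕ-Solver.solve-∀

peakBound⇔rankBound : ∀ {B d m β} → IsStrictPartition B → 1 ≤ d → suc (length B) ≡ d + m →
  All (_< length β + d) B ⇔ (entry (flatten d B ++ d ∷ β) 0 + 2 * m ≤ length (flatten d B ++ d ∷ β))
peakBound⇔rankBound {[]} {suc zero}    {zero}  _ _ refl = mk⇔ (λ _ → s≤s z≤n) (λ _ → [])
peakBound⇔rankBound {[]} {suc zero}    {suc _} _ _ ()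
peakBound⇔rankBound {[]} {suc (suc _)}         _ _ ()
peakBound⇔rankBound {b ∷ bs} {d} {m} {β} strict@(decreasing , _) _ eq = begin
  All (_< length β + d) (b ∷ bs)
    ≈⟨ decreasing-All<⇔head< decreasing ⟩
  b < length β + d
    ≈⟨ flatten-head-bound⇔ (strictPartition-head≥length strict) eq ⟨
  b + d ∸ length (b ∷ bs) + 2 * m ≤ length (b ∷ bs) + suc (length β)
    ≡⟨ cong (b + d ∸ length (b ∷ bs) + 2 * m ≤_) length-μ ⟨
  entry μ 0 + 2 * m ≤ length μ ∎
  where
  open SetoidReasoning (⇔-setoid 0ℓ)
  μ = flatten d (b ∷ bs) ++ d ∷ β
  length-μ : length μ ≡ length (b ∷ bs) + suc (length β)
  length-μ = trans (length-++ (flatten d (b ∷ bs))) (cong (_+ suc (length β)) (length-flatten d (b ∷ bs)))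

-- Chains and their gap partitions

data Chain : ℕ → List ℕ → ℕ → Set where
  end  : ∀ {lo hi} → lo < hi → Chain lo [] hi
  step : ∀ {lo a as hi} → lo < a → Chain a as hi → Chain lo (a ∷ as) hi

Chain⇔ : ∀ {lo A hi} → Chain lo A hi ⇔ (All (lo <_) A × Linked _<_ A × All (_< hi) A × lo < hi)
Chain⇔ = mk⇔ (λ chain → above chain , increasing chain , below chain , lo<hi chain)
             (λ (lo<A , increasing , A<hi , lo<hi) → build lo<A increasing A<hi lo<hi)
  where
  lo<hi : ∀ {lo A hi} → Chain lo A hi → lo < hi
  lo<hi (end lo<hi)       = lo<hi
  lo<hi (step lo<a chain) = <-trans lo<a (lo<hi chain)
  above : ∀ {lo A hi} → Chain lo A hi → All (lo <_) A
  above (end _)           = []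
  above (step lo<a chain) = lo<a ∷ All.map (<-trans lo<a) (above chain)
  increasing : ∀ {lo A hi} → Chain lo A hi → Linked _<_ A
  increasing (end _)                      = []
  increasing (step _ (end _))             = [-]
  increasing (step _ chain@(step a<a′ _)) = a<a′ ∷ increasing chain
  below : ∀ {lo A hi} → Chain lo A hi → All (_< hi) A
  below (end _)        = []
  below (step _ chain) = lo<hi chain ∷ below chain
  build : ∀ {lo A hi} → All (lo <_) A → Linked _<_ A → All (_< hi) A → lo < hi → Chain lo A hi
  build []           _          _            lo<hi = end lo<hi
  build (lo<a ∷ _)   increasing (a<hi ∷ A<hi) _    =
    step lo<a (build (linked⇒All-head <-trans increasing) (Linked.tail increasing) A<hi a<hi)

gapPartition : ℕ → List ℕ → ℕ → List ℕ
gapPartition lo []       hi = replicate (hi ∸ suc lo) 1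
gapPartition lo (a ∷ as) hi = replicate (a ∸ suc lo) (2 + length as) ++ gapPartition a as hi

gapPartition-≤ : ∀ lo A hi → All (_≤ suc (length A)) (gapPartition lo A hi)
gapPartition-≤ lo []       hi = All.replicate⁺ _ ≤-refl
gapPartition-≤ lo (a ∷ as) hi =
  All.++⁺ (All.replicate⁺ _ ≤-refl) (All.map m≤n⇒m≤1+n (gapPartition-≤ a as hi))

linked-replicate-++ : ∀ g v {ys} → All (_≤ v) ys → Linked _≥_ ys → Linked _≥_ (replicate g v ++ ys)
linked-replicate-++ zero    v ys≤v linked = linked
linked-replicate-++ (suc g) v ys≤v linked =
  linked-∷ (All.++⁺ (All.replicate⁺ g ≤-refl) ys≤v) (linked-replicate-++ g v ys≤v linked)

gapPartition-isPartition : ∀ lo A hi → IsPartition (gapPartition lo A hi)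
gapPartition-isPartition lo [] hi =
  subst (Linked _≥_) (++-identityʳ _) (linked-replicate-++ (hi ∸ suc lo) 1 [] []) , All.replicate⁺ _ ≤-refl
gapPartition-isPartition lo (a ∷ as) hi with gapPartition-isPartition a as hi
... | linked , pos =
  linked-replicate-++ (a ∸ suc lo) _ (All.map m≤n⇒m≤1+n (gapPartition-≤ a as hi)) linked ,
  All.++⁺ (All.replicate⁺ _ (s≤s z≤n)) pos

length-gapPartition : ∀ {lo A hi} → Chain lo A hi → length (gapPartition lo A hi) + suc (lo + length A) ≡ hi
length-gapPartition {lo} {[]} {hi} (end lo<hi) = begin
  length (replicate (hi ∸ suc lo) 1) + suc (lo + 0)
    ≡⟨ cong₂ (λ g l → g + suc l) (length-replicate (hi ∸ suc lo)) (+-identityʳ lo) ⟩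
  (hi ∸ suc lo) + suc lo
    ≡⟨ m∸n+n≡m lo<hi ⟩
  hi ∎
  where open ≡-Reasoning
length-gapPartition {lo} {a ∷ as} {hi} (step lo<a chain) = begin
  length (replicate g (2 + length as) ++ rest) + suc (lo + suc (length as))
    ≡⟨ cong (_+ suc (lo + suc (length as)))
            (trans (length-++ (replicate g _)) (cong (_+ length rest) (length-replicate g))) ⟩
  g + length rest + suc (lo + suc (length as))
    ≡⟨ regroup g (length rest) lo (length as) ⟩
  length rest + suc (suc (lo + g) + length as)
    ≡⟨ cong (λ x → length rest + suc (x + length as)) (m+[n∸m]≡n lo<a) ⟩
  length rest + suc (a + length as)
    ≡⟨ length-gapPartition chain ⟩
  hi ∎
  where
  open ≡-Reasoning
  g = a ∸ suc lo
  rest = gapPartition a as hi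
  regroup : ∀ g t lo l → g + t + suc (lo + suc l) ≡ t + suc (suc (lo + g) + l)
  regroup = ℕ-Solver.solve-∀

sum-replicate : ∀ g v → sum (replicate g v) ≡ g * v
sum-replicate zero    v = refl
sum-replicate (suc g) v = cong (λ x → v + x) (sum-replicate g v)

sum-gapPartition : ∀ {lo A hi} → Chain lo A hi →
  sum (gapPartition lo A hi) + lo * suc (length A) + triangle (2 + length A) ≡ sum A + hi
sum-gapPartition {lo} {[]} {hi} (end lo<hi) = begin
  sum (replicate (hi ∸ suc lo) 1) + lo * 1 + 1 ≡⟨ cong (λ s → s + lo * 1 + 1) (sum-replicate (hi ∸ suc lo) 1) ⟩
  (hi ∸ suc lo) * 1 + lo * 1 + 1             ≡⟨ regroup (hi ∸ suc lo) lo ⟩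
  suc lo + (hi ∸ suc lo)                     ≡⟨ m+[n∸m]≡n lo<hi ⟩
  hi                                         ∎
  where
  open ≡-Reasoning
  regroup : ∀ g lo → g * 1 + lo * 1 + 1 ≡ suc lo + g
  regroup = ℕ-Solver.solve-∀
sum-gapPartition {lo} {a ∷ as} {hi} (step lo<a chain) = begin
  sum (replicate g (2 + l) ++ rest) + lo * suc (suc l) + triangle (3 + l)
    ≡⟨ cong (λ s → s + lo * suc (suc l) + triangle (3 + l))
            (trans (sum-++ (replicate g _) rest) (cong (_+ sum rest) (sum-replicate g _))) ⟩
  g * (2 + l) + sum rest + lo * suc (suc l) + (suc (suc l) + (suc l + triangle (suc l)))
    ≡⟨ regroup g (sum rest) lo l (triangle (suc l)) ⟩
  suc (lo + g) + (sum rest + suc (lo + g) * suc l + triangle (2 + l))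
    ≡⟨ cong (λ x → x + (sum rest + x * suc l + triangle (2 + l))) (m+[n∸m]≡n lo<a) ⟩
  a + (sum rest + a * suc l + triangle (2 + l))
    ≡⟨ cong (λ x → a + x) (sum-gapPartition chain) ⟩
  a + (sum as + hi)
    ≡⟨ +-assoc a (sum as) hi ⟨
  a + sum as + hi ∎
  where
  open ≡-Reasoning
  g = a ∸ suc lo
  l = length as
  rest = gapPartition a as hi
  regroup : ∀ g s lo l t → g * (2 + l) + s + lo * suc (suc l) + (suc (suc l) + (suc l + t))
                         ≡ suc (lo + g) + (s + suc (lo + g) * suc l + (suc l + t))
  regroup = ℕ-Solver.solve-∀

leadingCopies : ℕ → List ℕ → ℕ
leadingCopies v []       = 0
leadingCopies v (x ∷ xs) with x ≟ v
... | yes _ = suc (leadingCopies v xs)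
... | no  _ = 0

leadingCopies-replicate-++ : ∀ g v {ys} → All (_< v) ys → leadingCopies v (replicate g v ++ ys) ≡ g
leadingCopies-replicate-++ zero    v []         = refl
leadingCopies-replicate-++ zero    v {y ∷ _} (y<v ∷ _) with y ≟ v
... | yes refl = contradiction y<v (<-irrefl refl)
... | no  _    = refl
leadingCopies-replicate-++ (suc g) v ys<v with v ≟ v
... | yes _   = cong suc (leadingCopies-replicate-++ g v ys<v)
... | no  v≢v = contradiction refl v≢v

drop-replicate-++ : ∀ g (v : X) ys → drop g (replicate g v ++ ys) ≡ ys
drop-replicate-++ zero    v ys = refl
drop-replicate-++ (suc g) v ys = drop-replicate-++ g v ys

replicate-leadingCopies-++-drop : ∀ v β → replicate (leadingCopies v β) v ++ drop (leadingCopies v β) β ≡ β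
replicate-leadingCopies-++-drop v []      = refl
replicate-leadingCopies-++-drop v (x ∷ β) with x ≟ v
... | yes refl = cong (x ∷_) (replicate-leadingCopies-++-drop v β)
... | no  _    = refl

drop-leadingCopies-≤ : ∀ c {β} → Linked _≥_ β → All (_≤ suc (suc c)) β →
  All (_≤ suc c) (drop (leadingCopies (suc (suc c)) β) β)
drop-leadingCopies-≤ c {[]}    _      []           = []
drop-leadingCopies-≤ c {x ∷ β} linked (x≤ ∷ β≤) with x ≟ suc (suc c)
... | yes _   = drop-leadingCopies-≤ c (Linked.tail linked) β≤
... | no  x≢  = x≤1+c ∷ All.map (λ y≤x → ≤-trans y≤x x≤1+c) (linked⇒All-head ≥-trans linked)
  where
  x≤1+c : x ≤ suc c
  x≤1+c = ≤-pred (≤∧≢⇒< x≤ x≢)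

replicate-length-1 : ∀ {β} → All (1 ≤_) β → All (_≤ 1) β → replicate (length β) 1 ≡ β
replicate-length-1 []           []           = refl
replicate-length-1 (1≤x ∷ 1≤xs) (x≤1 ∷ xs≤1) =
  cong₂ _∷_ (≤-antisym 1≤x x≤1) (replicate-length-1 1≤xs xs≤1)

-- Inverse of gapPartition lo on chains of length c: the multiplicity of the leading part c + 1
-- gives a₁ = lo + 1 + multiplicity, and for c = 0 the number of parts gives hi = lo + 1 + length.
unGap : ℕ → ℕ → List ℕ → List ℕ × ℕ
unGap lo zero    β = [] , suc (lo + length β)
unGap lo (suc c) β =
  let k = leadingCopies (2 + c) β in
  map₁ (suc (lo + k) ∷_) (unGap (suc (lo + k)) c (drop k β))

length-unGap : ∀ lo c β → length (proj₁ (unGap lo c β)) ≡ c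
length-unGap lo zero    β = refl
length-unGap lo (suc c) β = cong suc (length-unGap _ c _)

unGap-chain : ∀ lo c β → Chain lo (proj₁ (unGap lo c β)) (proj₂ (unGap lo c β))
unGap-chain lo zero    β = end (s≤s (m≤m+n lo _))
unGap-chain lo (suc c) β = step (s≤s (m≤m+n lo _)) (unGap-chain _ c _)

unGap-gapPartition : ∀ {lo A hi} → Chain lo A hi → unGap lo (length A) (gapPartition lo A hi) ≡ (A , hi)
unGap-gapPartition {lo} {[]} {hi} (end lo<hi) =
  cong ([] ,_) (trans (cong (λ l → suc (lo + l)) (length-replicate (hi ∸ suc lo))) (m+[n∸m]≡n lo<hi))
unGap-gapPartition {lo} {a ∷ as} {hi} (step lo<a chain)
  rewrite leadingCopies-replicate-++ (a ∸ suc lo) (2 + length as) (All.map s≤s (gapPartition-≤ a as hi))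
        | drop-replicate-++ (a ∸ suc lo) (2 + length as) (gapPartition a as hi)
        | m+[n∸m]≡n lo<a
        = cong (map₁ (a ∷_)) (unGap-gapPartition chain)

gapPartition-unGap : ∀ lo c {β} → IsPartition β → All (_≤ suc c) β →
  uncurry (gapPartition lo) (unGap lo c β) ≡ β
gapPartition-unGap lo zero {β} (_ , pos) β≤1
  rewrite m+n∸m≡n lo (length β) = replicate-length-1 pos β≤1
gapPartition-unGap lo (suc c) {β} (linked , pos) β≤ = begin
  replicate (suc (lo + k) ∸ suc lo) (2 + length (proj₁ rest)) ++ uncurry (gapPartition (suc (lo + k))) rest
    ≡⟨ cong₂ (λ g l → replicate g (2 + l) ++ uncurry (gapPartition (suc (lo + k))) rest)
             (m+n∸m≡n lo k) (length-unGap (suc (lo + k)) c (drop k β)) ⟩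
  replicate k (2 + c) ++ uncurry (gapPartition (suc (lo + k))) rest
    ≡⟨ cong (replicate k (2 + c) ++_)
            (gapPartition-unGap (suc (lo + k)) c (linked-drop k linked , All.drop⁺ k pos)
                                (drop-leadingCopies-≤ c linked β≤)) ⟩
  replicate k (2 + c) ++ drop k β
    ≡⟨ replicate-leadingCopies-++-drop (2 + c) β ⟩
  β ∎
  where
  open ≡-Reasoning
  k = leadingCopies (2 + c) β
  rest = unGap (suc (lo + k)) c (drop k β)

-- The bijection

IsStronglyUnimodal⇔ : ∀ {A p B} →
  IsStronglyUnimodal (sus A p B) ⇔ (Chain 0 A p × IsStrictPartition B × All (_< p) B)
IsStronglyUnimodal⇔ {A} = mk⇔
  (λ (pos , increasing , A<p , B<p , decreasing) →
    from Chain⇔ (All.++⁻ˡ A pos , increasing , A<p , All.head (All.++⁻ʳ A pos)) ,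
    (decreasing , All.tail (All.++⁻ʳ A pos)) , B<p)
  (λ (chain , (decreasing , B-pos) , B<p) →
    let (A-pos , increasing , A<p , p-pos) = to Chain⇔ chain in
    All.++⁺ A-pos (p-pos ∷ B-pos) , increasing , A<p , B<p , decreasing)

partitionOf : SUS → List ℕ
partitionOf (sus A p B) = flatten (suc (length A)) B ++ suc (length A) ∷ gapPartition 0 A p

unimodalOf : List ℕ → ℕ → SUS
unimodalOf μ j = sus (proj₁ increasingPart) (proj₂ increasingPart) (sharpen (entry μ j) (take j μ))
  where
  increasingPart = unGap 0 (pred (entry μ j)) (drop (suc j) μ)

module _ {A p B} (chain : Chain 0 A p) (strict : IsStrictPartition B) where

  private
    d = suc (length A)
    β = gapPartition 0 A p
    μ = partitionOf (sus A p B)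
    take-μ : take (length B) μ ≡ flatten d B
    take-μ = subst (λ l → take l μ ≡ flatten d B) (length-flatten d B) (take-++-length (flatten d B))
    drop-μ : drop (suc (length B)) μ ≡ β
    drop-μ = subst (λ l → drop (suc l) μ ≡ β) (length-flatten d B) (drop-++∷-length (flatten d B))

  partitionOf-isPartition : IsPartition μ
  partitionOf-isPartition = from (IsPartition-++∷⇔ (flatten d B)) (record
    { prefix-linked = flatten-linked d strict
    ; prefix-≥      = flatten-≥ d strict
    ; pivot-pos     = s≤s z≤n
    ; suffix        = gapPartition-isPartition 0 A p
    ; suffix-≤      = gapPartition-≤ 0 A p
    })

  partitionOf-rankSet : entry μ (length B) ≡ d
  partitionOf-rankSet = subst (λ l → entry μ l ≡ d) (length-flatten d B) (entry-++-length (flatten d B))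

  unimodalOf-partitionOf : unimodalOf μ (length B) ≡ sus A p B
  unimodalOf-partitionOf
    rewrite partitionOf-rankSet | take-μ | drop-μ | unGap-gapPartition chain | sharpen-flatten d strict
    = refl

  module _ {m} (lengths : suc (length B) ≡ d + m) where

    weightS-partitionOf : weightS (sus A p B) ≡ triangle m + sum (μ)
    weightS-partitionOf = +-cancelʳ-≡ (length B * d) _ _ (begin
      sum (A ++ p ∷ B) + length B * d
        ≡⟨ cong (_+ length B * d) (sum-++ A (p ∷ B)) ⟩
      sum A + (p + sum B) + length B * d
        ≡⟨ regroup (sum A) p (sum B) (length B * d) ⟩
      (sum A + p) + (sum B + length B * d)
        ≡⟨ cong₂ _+_ (sum-gapPartition chain) (sum-flatten d strict) ⟨
      (sum β + 0 + triangle (suc d)) + (sum (flatten d B) + triangle (suc (length B)))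
        ≡⟨ regroup′ (sum β) (triangle (suc d)) (sum (flatten d B)) (triangle (suc (length B))) ⟩
      (sum β + sum (flatten d B)) + (triangle (suc d) + triangle (suc (length B)))
        ≡⟨ cong (λ x → sum β + sum (flatten d B) + x) (triangle-[1+d]+triangle-[1+l] d m (length B) lengths) ⟩
      (sum β + sum (flatten d B)) + (d + triangle m + length B * d)
        ≡⟨ regroup″ (sum β) (sum (flatten d B)) d (triangle m) (length B * d) ⟩
      (triangle m + (sum (flatten d B) + (d + sum β))) + length B * d
        ≡⟨ cong (λ s → triangle m + s + length B * d) (sum-++ (flatten d B) (d ∷ β)) ⟨
      triangle m + sum (μ) + length B * d ∎)
      where
      open ≡-Reasoning
      regroup : ∀ a p b x → a + (p + b) + x ≡ (a + p) + (b + x)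
      regroup = ℕ-Solver.solve-∀
      regroup′ : ∀ s t f u → (s + 0 + t) + (f + u) ≡ (s + f) + (t + u)
      regroup′ = ℕ-Solver.solve-∀
      regroup″ : ∀ s f d t x → (s + f) + (d + t + x) ≡ (t + (f + (d + s))) + x
      regroup″ = ℕ-Solver.solve-∀

    peakBound⇔rankBound-partitionOf : All (_< p) B ⇔
      (entry (μ) 0 + 2 * m ≤ length (μ))
    peakBound⇔rankBound-partitionOf =
      subst (λ hi → All (_< hi) B ⇔ (entry (μ) 0 + 2 * m ≤ length (μ)))
            (length-gapPartition chain) (peakBound⇔rankBound {β = β} strict (s≤s z≤n) lengths)

module _ {μ j} (isPartition : IsPartition μ) (j<ℓ : j < length μ) where

  private
    d = entry μ j
    around = to (IsPartition-++∷⇔ (take j μ)) (subst IsPartition (sym (take++entry∷drop j j<ℓ)) isPartition)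
    open IsPartitionAround around
    chain = unGap-chain 0 (pred d) (drop (suc j) μ)
    suc-pred-d = suc-pred d {{>-nonZero pivot-pos}}

  length-after-unimodalOf : length (after (unimodalOf μ j)) ≡ j
  length-after-unimodalOf =
    trans (length-sharpen d (take j μ)) (trans (length-take j μ) (m≤n⇒m⊓n≡m (<⇒≤ j<ℓ)))

  suc-length-before-unimodalOf : suc (length (before (unimodalOf μ j))) ≡ d
  suc-length-before-unimodalOf = trans (cong suc (length-unGap 0 (pred d) _)) suc-pred-d

  unimodalOf-strict : IsStrictPartition (after (unimodalOf μ j))
  unimodalOf-strict = sharpen-strictPartition d prefix-linked

  partitionOf-unimodalOf : partitionOf (unimodalOf μ j) ≡ μ
  partitionOf-unimodalOf = begin
    flatten d′ (sharpen d (take j μ)) ++ d′ ∷ β′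
      ≡⟨ cong (λ e → flatten e (sharpen d (take j μ)) ++ e ∷ β′) suc-length-before-unimodalOf ⟩
    flatten d (sharpen d (take j μ)) ++ d ∷ β′
      ≡⟨ cong₂ (λ xs ys → xs ++ d ∷ ys)
               (flatten-sharpen d prefix-≥) (gapPartition-unGap 0 (pred d) suffix suffix-≤′) ⟩
    take j μ ++ d ∷ drop (suc j) μ
      ≡⟨ take++entry∷drop j j<ℓ ⟩
    μ ∎
    where
    open ≡-Reasoning
    d′ = suc (length (before (unimodalOf μ j)))
    β′ = uncurry (gapPartition 0) (unGap 0 (pred d) (drop (suc j) μ))
    suffix-≤′ = subst (λ e → All (_≤ e) (drop (suc j) μ)) (sym suc-pred-d) suffix-≤

  module _ {m} (rankSet : suc j ≡ d + m) where

    unimodalOf-lengths : suc (length (after (unimodalOf μ j))) ≡ suc (length (before (unimodalOf μ j))) + m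
    unimodalOf-lengths = begin
      suc (length (after (unimodalOf μ j)))      ≡⟨ cong suc length-after-unimodalOf ⟩
      suc j                                      ≡⟨ rankSet ⟩
      d + m                                      ≡⟨ cong (_+ m) suc-length-before-unimodalOf ⟨
      suc (length (before (unimodalOf μ j))) + m ∎
      where open ≡-Reasoning

    weightS-unimodalOf : weightS (unimodalOf μ j) ≡ triangle m + sum μ
    weightS-unimodalOf = trans (weightS-partitionOf chain unimodalOf-strict unimodalOf-lengths)
                               (cong (λ ν → triangle m + sum ν) partitionOf-unimodalOf)

    unimodalOf-isStronglyUnimodal : entry μ 0 + 2 * m ≤ length μ → IsStronglyUnimodal (unimodalOf μ j)
    unimodalOf-isStronglyUnimodal rankBound = from IsStronglyUnimodal⇔
      (chain , unimodalOf-strict ,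
       from (peakBound⇔rankBound-partitionOf chain unimodalOf-strict unimodalOf-lengths)
            (subst (λ ν → entry ν 0 + 2 * m ≤ length ν) (sym partitionOf-unimodalOf) rankBound))

IsPartition-irrelevant : ∀ μ → Irrelevant (IsPartition μ)
IsPartition-irrelevant μ (linked , pos) (linked′ , pos′) =
  cong₂ _,_ (Linked.irrelevant ≤-irrelevant linked linked′) (All.irrelevant ≤-irrelevant pos pos′)

IsStronglyUnimodal-irrelevant : ∀ s → Irrelevant (IsStronglyUnimodal s)
IsStronglyUnimodal-irrelevant s (a , b , c , d , e) (a′ , b′ , c′ , d′ , e′) =
  cong₂ _,_ (All.irrelevant ≤-irrelevant a a′) (cong₂ _,_ (Linked.irrelevant ≤-irrelevant b b′)
    (cong₂ _,_ (All.irrelevant ≤-irrelevant c c′) (cong₂ _,_ (All.irrelevant ≤-irrelevant d d′)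
      (Linked.irrelevant ≤-irrelevant e e′))))

ℤ-≡-irrelevant : UIP ℤ
ℤ-≡-irrelevant = Decidable⇒UIP.≡-irrelevant ℤ._≟_

SUSeq-≡ : ∀ {r n} {x y : SUSeq r n} → proj₁ x ≡ proj₁ y → x ≡ y
SUSeq-≡ {x = s , u , w , r} {y = .s , u′ , w′ , r′} refl =
  cong (s ,_) (cong₂ _,_ (IsStronglyUnimodal-irrelevant s u u′)
    (cong₂ _,_ (≡-irrelevant w w′) (ℤ-≡-irrelevant r r′)))

Part-≡ : ∀ {m N μ μ′ p p′ w w′ r r′ j j′ e e′} → μ ≡ μ′ → j ≡ j′ →
  _≡_ {A = Part m N} (μ , p , w , r , j , e) (μ′ , p′ , w′ , r′ , j′ , e′)
Part-≡ {μ = μ} {p = p} {p′} {w} {w′} {r} {r′} {j} {e = e} {e′} refl refl =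
  cong (μ ,_) (cong₂ _,_ (IsPartition-irrelevant μ p p′) (cong₂ _,_ (ℤ-≡-irrelevant w w′)
    (cong₂ _,_ (ℤ.≤-irrelevant r r′) (cong (j ,_) (ℤ-≡-irrelevant e e′)))))

module _ (m : ℕ) where

  rank-condition⇔ : ∀ A p B → (rankS (sus A p B) ≡ + m) ⇔ (suc (length B) ≡ suc (length A) + m)
  rank-condition⇔ A p B = mk⇔
    (λ rank → cong suc (to (pos-diff≡pos⇔ _ _ m) (trans (sym (rankS-sus A p B)) rank)))
    (λ lengths → trans (rankS-sus A p B) (from (pos-diff≡pos⇔ _ _ m) (suc-injective lengths)))

  rankSet-condition⇔ : ∀ j d → (+ j ℤ.- + d ≡ + m ℤ.- + 1) ⇔ (suc j ≡ d + m)
  rankSet-condition⇔ j d = mk⇔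
    (λ eq → trans (+-comm 1 j) (to (pos-diff≡pos-diff⇔ j d m 1) eq))
    (λ eq → from (pos-diff≡pos-diff⇔ j d m 1) (trans (+-comm j 1) eq))

  weight-condition⇔ : ∀ n s → (+ s ≡ + n ℤ.- + (m C 2)) ⇔ (n ≡ triangle m + s)
  weight-condition⇔ n s = mk⇔
    (λ eq → trans (to (pos-diff≡pos⇔ n (m C 2) s) (sym eq)) (cong (_+ s) (C2≡triangle m)))
    (λ eq → sym (from (pos-diff≡pos⇔ n (m C 2) s) (trans eq (cong (_+ s) (sym (C2≡triangle m))))))

module _ (m n : ℕ) where

  toPartition : SUSeq (+ m) n → Part m (+ n ℤ.- + (m C 2))
  toPartition (sus A p B , unimodal , weight , rank) =
    let (chain , strict , B<p) = to IsStronglyUnimodal⇔ unimodal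
        lengths = to (rank-condition⇔ m A p B) rank
    in partitionOf (sus A p B)
     , partitionOf-isPartition chain strict
     , from (weight-condition⇔ m n _) (trans (sym weight) (weightS-partitionOf chain strict lengths))
     , from (pos-diff≤-2*⇔ _ _ m) (to (peakBound⇔rankBound-partitionOf chain strict lengths) B<p)
     , length B
     , from (rankSet-condition⇔ m _ _) (trans lengths (cong (_+ m) (sym (partitionOf-rankSet chain strict))))

  toUnimodal : Part m (+ n ℤ.- + (m C 2)) → SUSeq (+ m) n
  toUnimodal (μ , isPartition , weight , rankBound , j , rankSet) =
    let rankBound′ = to (pos-diff≤-2*⇔ (entry μ 0) (length μ) m) rankBound
        rankSet′   = to (rankSet-condition⇔ m j (entry μ j)) rankSet
        j<ℓ        = rankSet-index<length {μ} rankSet′ rankBound′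
        s          = unimodalOf μ j
    in s
     , unimodalOf-isStronglyUnimodal isPartition j<ℓ rankSet′ rankBound′
     , trans (weightS-unimodalOf isPartition j<ℓ rankSet′) (sym (to (weight-condition⇔ m n (sum μ)) weight))
     , from (rank-condition⇔ m (before s) (peak s) (after s)) (unimodalOf-lengths isPartition j<ℓ rankSet′)

  toPartition∘toUnimodal : ∀ y → toPartition (toUnimodal y) ≡ y
  toPartition∘toUnimodal (μ , isPartition , _ , rankBound , j , rankSet) =
    Part-≡ {m = m} (partitionOf-unimodalOf isPartition j<ℓ) (length-after-unimodalOf isPartition j<ℓ)
    where
    j<ℓ = rankSet-index<length {μ} (to (rankSet-condition⇔ m j (entry μ j)) rankSet)
                                   (to (pos-diff≤-2*⇔ (entry μ 0) (length μ) m) rankBound)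

  toUnimodal∘toPartition : ∀ x → toUnimodal (toPartition x) ≡ x
  toUnimodal∘toPartition (sus A p B , unimodal , _) =
    let (chain , strict , _) = to IsStronglyUnimodal⇔ unimodal in
    SUSeq-≡ (unimodalOf-partitionOf chain strict)

corollary1p5 : (m n : ℕ) →
    SUSeq (+ m) n ↔ Part m ((+ n) ℤ.- (+ (m C 2)))
corollary1p5 m n =
  mk↔ₛ′ (toPartition m n) (toUnimodal m n) (toPartition∘toUnimodal m n) (toUnimodal∘toPartition m n)
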